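{- For every integer $k\ge 2$ we have $m(k,2;2^{k-2})=2^k-1$.
   Context: A linear $[n,k]_q$-code is a $k$-dimensional subspace of $\mathbb{F}_q^n$. The support of $c\in\mathbb{F}_q^n$ is $\operatorname{supp}(c)=\{i: c_i\neq 0\}$. A non-zero codeword $c$ of a linear code $C$ is minimal if no non-zero codeword $u\in C$ has $\operatorname{supp}(u)\subsetneq\operatorname{supp}(c)$; $C$ is a minimal code if all its non-zero codewords are minimal. A linear code is $\Delta$-divisible if the Hamming weights of all its codewords are divisible by $\Delta$. For positive integers $k,\Delta$, $m(k,q;\Delta)$ denotes the minimum length $n$ of a $\Delta$-divisible minimal $[n,k]_q$-code. -}

module Defs where

open import Data.Nat using (ℕ; zero; suc; _+_; _≤_)
open import Data.Nat.Divisibility using (_∣_)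
open import Data.Bool using (Bool; true; false; _xor_; _∧_)
open import Data.Fin using (Fin; zero; suc)
open import Data.Product using (∃; _×_; Σ)
open import Relation.Binary.PropositionalEquality using (_≡_)
open import Relation.Nullary using (¬_)

-- The field F_2 is modelled by Bool, with addition _xor_ and multiplication _∧_.
-- Vectors in F_2^n are functions Fin n → Bool.
Word : ℕ → Set
Word n = Fin n → Bool

Σ₂ : ∀ {k} → (Fin k → Bool) → Bool
Σ₂ {zero}  f = false
Σ₂ {suc k} f = f zero xor Σ₂ (λ i → f (suc i))

wt : ∀ {n} → Word n → ℕ
wt {zero}  c = 0
wt {suc n} c with c zero
... | true  = suc (wt (λ i → c (suc i)))
... | false = wt (λ i → c (suc i))

GenMatrix : ℕ → ℕ → Set
GenMatrix k n = Fin k → Word n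

encode : ∀ {k n} → GenMatrix k n → Word k → Word n
encode G x j = Σ₂ (λ i → x i ∧ G i j)

IsZero : ∀ {n} → Word n → Set
IsZero c = ∀ j → c j ≡ false

FullRank : ∀ {k n} → GenMatrix k n → Set
FullRank G = ∀ x → IsZero (encode G x) → IsZero x

-- An [n,k]_2 linear code: a k-dimensional subspace of F_2^n, presented as the
-- row space of a full-rank generator matrix. Its codewords are encode G x.
record LinCode (n k : ℕ) : Set where
  constructor code
  field
    gen      : GenMatrix k n
    fullRank : FullRank gen
open LinCode public

SuppStrictSub : ∀ {n} → Word n → Word n → Set
SuppStrictSub u c = (∀ j → u j ≡ true → c j ≡ true) × ∃ λ j → (c j ≡ true) × (u j ≡ false)

IsMinimal : ∀ {n k} → LinCode n k → Set
IsMinimal C = ∀ x y → ¬ IsZero (encode (gen C) x) → ¬ IsZero (encode (gen C) y)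
              → ¬ SuppStrictSub (encode (gen C) y) (encode (gen C) x)

IsDivisible : ∀ {n k} → ℕ → LinCode n k → Set
IsDivisible Δ C = ∀ x → Δ ∣ wt (encode (gen C) x)

HasDivMinCode : ℕ → ℕ → ℕ → Set
HasDivMinCode n k Δ = Σ (LinCode n k) λ C → IsDivisible Δ C × IsMinimal C

MinLengthIs : ℕ → ℕ → ℕ → Set
MinLengthIs k Δ n = HasDivMinCode n k Δ × (∀ n' → HasDivMinCode n' k Δ → n ≤ n')

module Submission where

-- Summing the weights of all 2ᵏ codewords of an [n,k]₂ code counts every non-zero column 2ᵏ⁻¹ times.
-- For a 2ᵏ⁻²-divisible code write wt(xG) = a(x)·2ᵏ⁻²; then Σₓ a(x) = 2N, where N ≤ n is the number of
-- non-zero columns. If the code is also minimal, no codeword has weight 2ᵏ⁻²: for wt(x₀G) = 2ᵏ⁻², a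
-- non-zero codeword xG heavier than (x + x₀)G would have (x + x₀)G = xG + x₀G supported strictly inside
-- it, so a(x) = a(x + x₀) for x ∉ {0, x₀}, and pairing x with x + x₀ makes Σₓ a(x) odd. Hence a(x) ≥ 2
-- for x ≠ 0 and 2(2ᵏ − 1) ≤ 2N ≤ 2n. The simplex code, whose columns are the 2ᵏ − 1 non-zero vectors,
-- attains the bound: all its non-zero codewords have weight 2ᵏ⁻¹.

open import Algebra.Bundles using (CommutativeRing)
open import Data.Bool using (Bool; true; false; not; _∧_; _xor_)
open import Data.Bool.Properties
  using (∧-comm; ∧-zeroʳ; ∧-distribʳ-xor; xor-assoc; xor-same; xor-identityʳ; xor-comm; not-injective; xor-∧-commutativeRing)
open import Data.Empty using (⊥-elim)
open import Data.Fin using (Fin; zero; suc; _↑ˡ_; _↑ʳ_)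
open import Data.Nat using (ℕ; zero; suc; _+_; _*_; _∸_; _^_; _≤_; _<_; z≤n; s≤s; NonZero)
open import Data.Nat.Divisibility using (_∣_; divides; ∣-trans; n∣m*n; ∣m∣n⇒∣m+n; ∣m+n∣m⇒∣n; ∣1⇒≡1)
open import Data.Nat.Properties
open import Data.Nat.Tactic.RingSolver using (solve-∀)
open import Data.Product using (∃; _×_; _,_; proj₁; proj₂)
open import Data.Vec.Functional using (Vector; []; _∷_; _++_; map)
open import Data.Vec.Functional.Properties using (lookup-++ˡ; lookup-++ʳ)
open import Function using (_∘_)
open import Relation.Binary.Core using (_Preserves_⟶_)
open import Relation.Binary.PropositionalEquality
open import Relation.Nullary using (¬_; yes; no)

open import Defs

open import Algebra.Properties.Semiring.Sum +-*-semiring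
  using (sum; sum-cong-≗; ∑-distrib-+; *-distribˡ-sum; *-distribʳ-sum)
open import Algebra.Properties.CommutativeSemigroup +-commutativeSemigroup
  using () renaming (interchange to +-interchange)
open import Algebra.Properties.CommutativeSemigroup
  (CommutativeRing.+-commutativeSemigroup xor-∧-commutativeRing)
  using () renaming (interchange to xor-interchange)

bit : Bool → ℕ
bit true  = 1
bit false = 0

bit≤1 : ∀ b → bit b ≤ 1
bit≤1 true  = s≤s z≤n
bit≤1 false = z≤n

bit-not : ∀ b → bit b + bit (not b) ≡ 1
bit-not true  = refl
bit-not false = refl

bit≡0⇒false : ∀ {b} → bit b ≡ 0 → b ≡ false
bit≡0⇒false {false} _ = refl

bit-xor-∧ : ∀ a b → bit a + bit b ≡ bit (a xor b) + 2 * bit (a ∧ b)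
bit-xor-∧ true  true  = refl
bit-xor-∧ true  false = refl
bit-xor-∧ false true  = refl
bit-xor-∧ false false = refl

2∣m+m : ∀ m → 2 ∣ m + m
2∣m+m m = divides m (trans (cong (m +_) (sym (+-identityʳ m))) (*-comm 2 m))

sum-mono-≤ : ∀ {n} {f g : Vector ℕ n} → (∀ i → f i ≤ g i) → sum f ≤ sum g
sum-mono-≤ {zero}  f≤g = z≤n
sum-mono-≤ {suc n} f≤g = +-mono-≤ (f≤g zero) (sum-mono-≤ (f≤g ∘ suc))

sum-mono-< : ∀ {n} {f g : Vector ℕ n} → (∀ i → f i ≤ g i) → ∀ j → f j < g j → sum f < sum g
sum-mono-< {suc n} f≤g zero    fj<gj = +-mono-<-≤ fj<gj (sum-mono-≤ (f≤g ∘ suc))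
sum-mono-< {suc n} f≤g (suc j) fj<gj = +-mono-≤-< (f≤g zero) (sum-mono-< (f≤g ∘ suc) j fj<gj)

sum≡0⇒≡0 : ∀ {n} (f : Vector ℕ n) → sum f ≡ 0 → ∀ i → f i ≡ 0
sum≡0⇒≡0 {suc n} f eq zero    = m+n≡0⇒m≡0 (f zero) eq
sum≡0⇒≡0 {suc n} f eq (suc i) = sum≡0⇒≡0 (f ∘ suc) (m+n≡0⇒n≡0 (f zero) eq) i

sum-bit≤ : ∀ {n} (b : Vector Bool n) → sum (bit ∘ b) ≤ n
sum-bit≤ {zero}  b = z≤n
sum-bit≤ {suc n} b = +-mono-≤ (bit≤1 (b zero)) (sum-bit≤ (b ∘ suc))

sum-↑ : ∀ m {n} (h : Vector ℕ (m + n)) → sum h ≡ sum (h ∘ (_↑ˡ n)) + sum (h ∘ (m ↑ʳ_))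
sum-↑ zero    h = refl
sum-↑ (suc m) h = trans (cong (h zero +_) (sum-↑ m (h ∘ suc))) (sym (+-assoc (h zero) _ _))

sum-++ : ∀ {A : Set} {m n} (f : A → ℕ) (xs : Vector A m) (ys : Vector A n) →
         sum (map f (xs ++ ys)) ≡ sum (map f xs) + sum (map f ys)
sum-++ {m = m} f xs ys = trans (sum-↑ m (map f (xs ++ ys)))
  (cong₂ _+_ (sum-cong-≗ (cong f ∘ lookup-++ˡ xs ys)) (sum-cong-≗ (cong f ∘ lookup-++ʳ xs ys)))

Σ₂-cong : ∀ {k} {f g : Fin k → Bool} → f ≗ g → Σ₂ f ≡ Σ₂ g
Σ₂-cong {zero}  f≗g = refl
Σ₂-cong {suc k} f≗g = cong₂ _xor_ (f≗g zero) (Σ₂-cong (f≗g ∘ suc))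

Σ₂-false : ∀ {k} → Σ₂ {k} (λ _ → false) ≡ false
Σ₂-false {zero}  = refl
Σ₂-false {suc k} = Σ₂-false {k}

Σ₂-xor : ∀ {k} (f g : Fin k → Bool) → Σ₂ (λ i → f i xor g i) ≡ Σ₂ f xor Σ₂ g
Σ₂-xor {zero}  f g = refl
Σ₂-xor {suc k} f g = trans (cong ((f zero xor g zero) xor_) (Σ₂-xor (f ∘ suc) (g ∘ suc)))
                           (xor-interchange (f zero) (g zero) (Σ₂ (f ∘ suc)) (Σ₂ (g ∘ suc)))

zeros : ∀ {k} → Word k
zeros _ = false

_⊕_ : ∀ {k} → Word k → Word k → Word k
(x ⊕ y) i = x i xor y i

_⋆_ : ∀ {k} → Word k → Word k → Word k
(x ⋆ y) i = x i ∧ y i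

_·_ : ∀ {k} → Word k → Word k → Bool
x · y = Σ₂ (x ⋆ y)

isZeroᵇ : ∀ {k} → Word k → Bool
isZeroᵇ {zero}  x = true
isZeroᵇ {suc k} x = not (x zero) ∧ isZeroᵇ (x ∘ suc)

∷-cong : ∀ {k} b {x y : Word k} → x ≗ y → (b ∷ x) ≗ (b ∷ y)
∷-cong b x≗y zero    = refl
∷-cong b x≗y (suc i) = x≗y i

∷-⊕ : ∀ {k} b (x : Word k) (v : Word (suc k)) → ((b ∷ x) ⊕ v) ≗ ((b xor v zero) ∷ (x ⊕ (v ∘ suc)))
∷-⊕ b x v zero    = refl
∷-⊕ b x v (suc i) = refl

⊕-identityˡ : ∀ {k} {x : Word k} → IsZero x → ∀ y → (x ⊕ y) ≗ y
⊕-identityˡ x≡0 y i = cong (_xor y i) (x≡0 i)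

⊕-cancelʳ : ∀ {k} (x y : Word k) → ((x ⊕ y) ⊕ y) ≗ x
⊕-cancelʳ x y i = trans (xor-assoc (x i) (y i) (y i)) (trans (cong (x i xor_) (xor-same (y i))) (xor-identityʳ (x i)))

IsZero-⊕⇒≗ : ∀ {k} {x y : Word k} → IsZero (x ⊕ y) → x ≗ y
IsZero-⊕⇒≗ {x = x} {y} x⊕y≡0 i = trans (sym (⊕-cancelʳ x y i)) (cong (_xor y i) (x⊕y≡0 i))

·-comm : ∀ {k} (x y : Word k) → x · y ≡ y · x
·-comm x y = Σ₂-cong (λ i → ∧-comm (x i) (y i))

·-congˡ : ∀ {k} (x : Word k) {y z : Word k} → y ≗ z → x · y ≡ x · z
·-congˡ x y≗z = Σ₂-cong (λ i → cong (x i ∧_) (y≗z i))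

·-zerosʳ : ∀ {k} (x : Word k) → x · zeros ≡ false
·-zerosʳ {k} x = trans (Σ₂-cong (λ i → ∧-zeroʳ (x i))) (Σ₂-false {k})

isZeroᵇ-cong : ∀ {k} {x y : Word k} → x ≗ y → isZeroᵇ x ≡ isZeroᵇ y
isZeroᵇ-cong {zero}  x≗y = refl
isZeroᵇ-cong {suc k} x≗y = cong₂ (λ a b → not a ∧ b) (x≗y zero) (isZeroᵇ-cong (x≗y ∘ suc))

isZeroᵇ⇒IsZero : ∀ {k} {x : Word k} → isZeroᵇ x ≡ true → IsZero x
isZeroᵇ⇒IsZero {suc k} {x} eq i with x zero in x₀
isZeroᵇ⇒IsZero {suc k} {x} eq zero    | false = x₀
isZeroᵇ⇒IsZero {suc k} {x} eq (suc i) | false = isZeroᵇ⇒IsZero eq i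

IsZero⇒isZeroᵇ : ∀ {k} {x : Word k} → IsZero x → isZeroᵇ x ≡ true
IsZero⇒isZeroᵇ {zero}      x≡0 = refl
IsZero⇒isZeroᵇ {suc k} {x} x≡0 rewrite x≡0 zero = IsZero⇒isZeroᵇ (x≡0 ∘ suc)

¬IsZero⇒∃true : ∀ {k} (x : Word k) → ¬ IsZero x → ∃ λ i → x i ≡ true
¬IsZero⇒∃true {zero}  x x≢0 = ⊥-elim (x≢0 (λ ()))
¬IsZero⇒∃true {suc k} x x≢0 with x zero in x₀
... | true  = zero , x₀
... | false with ¬IsZero⇒∃true (x ∘ suc) (λ x'≡0 → x≢0 λ { zero → x₀ ; (suc i) → x'≡0 i })
...   | i , xi = suc i , xi

wt≡sum : ∀ {n} (c : Word n) → wt c ≡ sum (bit ∘ c)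
wt≡sum {zero}  c = refl
wt≡sum {suc n} c with c zero
... | true  = cong suc (wt≡sum (c ∘ suc))
... | false = wt≡sum (c ∘ suc)

wt-cong : ∀ {n} {c d : Word n} → c ≗ d → wt c ≡ wt d
wt-cong {c = c} {d} c≗d = trans (wt≡sum c) (trans (sum-cong-≗ (cong bit ∘ c≗d)) (sym (wt≡sum d)))

IsZero⇒wt≡0 : ∀ {n} {c : Word n} → IsZero c → wt c ≡ 0
IsZero⇒wt≡0 {zero}      c≡0 = refl
IsZero⇒wt≡0 {suc n} {c} c≡0 rewrite c≡0 zero = IsZero⇒wt≡0 (c≡0 ∘ suc)

wt≡0⇒IsZero : ∀ {n} {c : Word n} → wt c ≡ 0 → IsZero c
wt≡0⇒IsZero {c = c} eq j = bit≡0⇒false (sum≡0⇒≡0 (bit ∘ c) (trans (sym (wt≡sum c)) eq) j)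

SuppStrictSub⇒wt< : ∀ {n} {u c : Word n} → SuppStrictSub u c → wt u < wt c
SuppStrictSub⇒wt< {u = u} {c} (u⊆c , j , cj , uj) = subst₂ _<_ (sym (wt≡sum u)) (sym (wt≡sum c))
  (sum-mono-< bit-mono j (subst₂ (λ a b → bit a < bit b) (sym uj) (sym cj) (s≤s z≤n)))
  where
  bit-mono : ∀ i → bit (u i) ≤ bit (c i)
  bit-mono i with u i in ui
  ... | false = z≤n
  ... | true rewrite u⊆c i ui = s≤s z≤n

wt-+ : ∀ {n} (x y : Word n) → wt x + wt y ≡ wt (x ⊕ y) + 2 * wt (x ⋆ y)
wt-+ x y = begin
  wt x + wt y                                              ≡⟨ cong₂ _+_ (wt≡sum x) (wt≡sum y) ⟩
  sum (bit ∘ x) + sum (bit ∘ y)                            ≡⟨ ∑-distrib-+ (bit ∘ x) (bit ∘ y) ⟨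
  sum (λ i → bit (x i) + bit (y i))                        ≡⟨ sum-cong-≗ (λ i → bit-xor-∧ (x i) (y i)) ⟩
  sum (λ i → bit ((x ⊕ y) i) + 2 * bit ((x ⋆ y) i))        ≡⟨ ∑-distrib-+ (bit ∘ (x ⊕ y)) _ ⟩
  sum (bit ∘ (x ⊕ y)) + sum (λ i → 2 * bit ((x ⋆ y) i))    ≡⟨ cong₂ _+_ (wt≡sum (x ⊕ y)) (*-distribˡ-sum 2 (bit ∘ (x ⋆ y))) ⟨
  wt (x ⊕ y) + 2 * sum (bit ∘ (x ⋆ y))                     ≡⟨ cong (λ t → wt (x ⊕ y) + 2 * t) (wt≡sum (x ⋆ y)) ⟨
  wt (x ⊕ y) + 2 * wt (x ⋆ y)                              ∎
  where open ≡-Reasoning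

-- If wt v + wt w ≤ wt u for w = u ⊕ v, the identity wt-+ forces v and w to have disjoint supports.
tight-triangle⇒SuppStrictSub : ∀ {n} (u v w : Word n) → w ≗ (u ⊕ v) → ¬ IsZero v →
                               wt v + wt w ≤ wt u → SuppStrictSub w u
tight-triangle⇒SuppStrictSub u v w w≗u⊕v v≢0 tight = w⊆u , witness
  where
  v⊕w≗u : (v ⊕ w) ≗ u
  v⊕w≗u i = begin
    v i xor w i            ≡⟨ cong (v i xor_) (w≗u⊕v i) ⟩
    v i xor (u i xor v i)  ≡⟨ cong (v i xor_) (xor-comm (u i) (v i)) ⟩
    v i xor (v i xor u i)  ≡⟨ xor-assoc (v i) (v i) (u i) ⟨
    (v i xor v i) xor u i  ≡⟨ cong (_xor u i) (xor-same (v i)) ⟩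
    u i                    ∎
    where open ≡-Reasoning

  2*wt[v⋆w]≤0 : 2 * wt (v ⋆ w) ≤ 0
  2*wt[v⋆w]≤0 = +-cancelˡ-≤ (wt u) _ _ (begin
    wt u + 2 * wt (v ⋆ w)        ≡⟨ cong (_+ 2 * wt (v ⋆ w)) (wt-cong v⊕w≗u) ⟨
    wt (v ⊕ w) + 2 * wt (v ⋆ w)  ≡⟨ wt-+ v w ⟨
    wt v + wt w                  ≤⟨ tight ⟩
    wt u                         ≡⟨ +-identityʳ (wt u) ⟨
    wt u + 0                     ∎)
    where open ≤-Reasoning

  disjoint : IsZero (v ⋆ w)
  disjoint = wt≡0⇒IsZero (n≤0⇒n≡0 (*-cancelˡ-≤ 2 (≤-trans 2*wt[v⋆w]≤0 z≤n)))

  per-coordinate : ∀ a b → b ∧ (a xor b) ≡ false →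
                   (a xor b ≡ true → a ≡ true) × (b ≡ true → a ≡ true × a xor b ≡ false)
  per-coordinate true  true  _  = (λ ()) , λ _ → refl , refl
  per-coordinate true  false _  = (λ _ → refl) , λ ()
  per-coordinate false false _  = (λ ()) , λ ()

  at : ∀ i → (w i ≡ true → u i ≡ true) × (v i ≡ true → u i ≡ true × w i ≡ false)
  at i rewrite w≗u⊕v i = per-coordinate (u i) (v i) (subst (λ t → v i ∧ t ≡ false) (w≗u⊕v i) (disjoint i))

  w⊆u : ∀ i → w i ≡ true → u i ≡ true
  w⊆u i = proj₁ (at i)

  witness : ∃ λ i → (u i ≡ true) × (w i ≡ false)
  witness with ¬IsZero⇒∃true v v≢0
  ... | i , vi = i , proj₂ (at i) vi

sumCube : ∀ {k} → (Word k → ℕ) → ℕ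
sumCube {zero}  f = f []
sumCube {suc k} f = sumCube (f ∘ (false ∷_)) + sumCube (f ∘ (true ∷_))

sumCube-cong : ∀ {k} {f g : Word k → ℕ} → (∀ x → f x ≡ g x) → sumCube f ≡ sumCube g
sumCube-cong {zero}  f≡g = f≡g []
sumCube-cong {suc k} f≡g = cong₂ _+_ (sumCube-cong (f≡g ∘ (false ∷_))) (sumCube-cong (f≡g ∘ (true ∷_)))

sumCube-distrib-+ : ∀ {k} (f g : Word k → ℕ) → sumCube (λ x → f x + g x) ≡ sumCube f + sumCube g
sumCube-distrib-+ {zero}  f g = refl
sumCube-distrib-+ {suc k} f g = trans
  (cong₂ _+_ (sumCube-distrib-+ (f ∘ (false ∷_)) (g ∘ (false ∷_))) (sumCube-distrib-+ (f ∘ (true ∷_)) (g ∘ (true ∷_))))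
  (+-interchange (sumCube (f ∘ (false ∷_))) _ _ _)

sumCube-*ʳ : ∀ {k} (f : Word k → ℕ) c → sumCube (λ x → f x * c) ≡ sumCube f * c
sumCube-*ʳ {zero}  f c = refl
sumCube-*ʳ {suc k} f c = trans (cong₂ _+_ (sumCube-*ʳ (f ∘ (false ∷_)) c) (sumCube-*ʳ (f ∘ (true ∷_)) c))
                               (sym (*-distribʳ-+ c (sumCube (f ∘ (false ∷_))) _))

sumCube-const : ∀ {k} c → sumCube {k} (λ _ → c) ≡ c * 2 ^ k
sumCube-const {zero}  c = sym (*-identityʳ c)
sumCube-const {suc k} c = trans (cong₂ _+_ (sumCube-const {k} c) (sumCube-const {k} c)) (lemma c (2 ^ k))
  where
  lemma : ∀ a b → a * b + a * b ≡ a * (2 * b)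
  lemma = solve-∀

sumCube-mono-≤ : ∀ {k} {f g : Word k → ℕ} → (∀ x → f x ≤ g x) → sumCube f ≤ sumCube g
sumCube-mono-≤ {zero}  f≤g = f≤g []
sumCube-mono-≤ {suc k} f≤g = +-mono-≤ (sumCube-mono-≤ (f≤g ∘ (false ∷_))) (sumCube-mono-≤ (f≤g ∘ (true ∷_)))

sumCube-sum-comm : ∀ {k n} (h : Word k → Fin n → ℕ) → sumCube (sum ∘ h) ≡ sum (λ j → sumCube (λ x → h x j))
sumCube-sum-comm {zero}  h = refl
sumCube-sum-comm {suc k} h = trans
  (cong₂ _+_ (sumCube-sum-comm (h ∘ (false ∷_))) (sumCube-sum-comm (h ∘ (true ∷_))))
  (sym (∑-distrib-+ (λ j → sumCube (λ x → h (false ∷ x) j)) _))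

sumCube-isZeroᵇ : ∀ {k} → sumCube {k} (bit ∘ isZeroᵇ) ≡ 1
sumCube-isZeroᵇ {zero}  = refl
sumCube-isZeroᵇ {suc k} = cong₂ _+_ (sumCube-isZeroᵇ {k}) (sumCube-const {k} 0)

sumCube-translate : ∀ {k} {f : Word k → ℕ} → f Preserves _≗_ ⟶ _≡_ →
                    ∀ v → sumCube (λ x → f (x ⊕ v)) ≡ sumCube f
sumCube-translate {zero}  f-cong v = f-cong (λ ())
sumCube-translate {suc k} {f} f-cong v = trans (cong₂ _+_ (half false) (half true)) (halves (v zero))
  where
  half : ∀ b → sumCube (λ x → f ((b ∷ x) ⊕ v)) ≡ sumCube (f ∘ ((b xor v zero) ∷_))
  half b = trans (sumCube-cong (λ x → f-cong (∷-⊕ b x v)))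
                 (sumCube-translate (f-cong ∘ ∷-cong (b xor v zero)) (v ∘ suc))

  halves : ∀ b → sumCube (f ∘ (b ∷_)) + sumCube (f ∘ (not b ∷_)) ≡ sumCube f
  halves false = refl
  halves true  = +-comm (sumCube (f ∘ (true ∷_))) _

-- Translation by v ≠ 0 is a fixed-point-free involution, so its orbits pair up the points of F₂ᵏ.
translation-invariant⇒2∣sumCube : ∀ {k} {f : Word k → ℕ} → f Preserves _≗_ ⟶ _≡_ →
                                  ∀ {v} → isZeroᵇ v ≡ false → (∀ x → f (x ⊕ v) ≡ f x) → 2 ∣ sumCube f
translation-invariant⇒2∣sumCube {suc k} {f} f-cong {v} v≢0 invariant with v zero in v₀
... | true  = subst (λ t → 2 ∣ t + sumCube (f ∘ (true ∷_))) (sym falseHalf≡trueHalf) (2∣m+m (sumCube (f ∘ (true ∷_))))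
  where
  falseHalf≡trueHalf : sumCube (f ∘ (false ∷_)) ≡ sumCube (f ∘ (true ∷_))
  falseHalf≡trueHalf = trans
    (sumCube-cong (λ x → trans (sym (invariant (false ∷ x)))
                               (f-cong (λ i → trans (∷-⊕ false x v i) (cong (λ b → (b ∷ (x ⊕ (v ∘ suc))) i) v₀)))))
    (sumCube-translate (f-cong ∘ ∷-cong true) (v ∘ suc))
... | false = ∣m∣n⇒∣m+n (half false) (half true)
  where
  half : ∀ b → 2 ∣ sumCube (f ∘ (b ∷_))
  half b = translation-invariant⇒2∣sumCube (f-cong ∘ ∷-cong b) v≢0
    (λ x → trans (f-cong (λ i → sym (b∷x⊕v≗b∷[x⊕v'] x i))) (invariant (b ∷ x)))
    where
    b∷x⊕v≗b∷[x⊕v'] : ∀ x → ((b ∷ x) ⊕ v) ≗ (b ∷ (x ⊕ (v ∘ suc)))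
    b∷x⊕v≗b∷[x⊕v'] x zero    = trans (cong (b xor_) v₀) (xor-identityʳ b)
    b∷x⊕v≗b∷[x⊕v'] x (suc i) = refl

onesOf : ∀ {k} → Word k → ℕ
onesOf g = sumCube (λ x → bit (x · g))

2*onesOf : ∀ {k} (g : Word k) → 2 * onesOf g ≡ bit (not (isZeroᵇ g)) * 2 ^ k
2*onesOf {zero}  g = refl
2*onesOf {suc k} g with g zero in g₀
... | false = begin
  2 * (onesOf g' + onesOf g')            ≡⟨ *-distribˡ-+ 2 (onesOf g') (onesOf g') ⟩
  2 * onesOf g' + 2 * onesOf g'          ≡⟨ cong (λ t → t + t) (2*onesOf g') ⟩
  z' * 2 ^ k + z' * 2 ^ k                ≡⟨ double z' (2 ^ k) ⟩
  z' * 2 ^ suc k                         ∎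
  where
  open ≡-Reasoning
  g' = g ∘ suc
  z' = bit (not (isZeroᵇ g'))
  double : ∀ a b → a * b + a * b ≡ a * (2 * b)
  double = solve-∀
... | true = begin
  2 * (onesOf g' + sumCube (λ x → bit (not (x · g'))))    ≡⟨ cong (2 *_) (sumCube-distrib-+ (λ x → bit (x · g')) _) ⟨
  2 * sumCube (λ x → bit (x · g') + bit (not (x · g')))   ≡⟨ cong (2 *_) (sumCube-cong (λ x → bit-not (x · g'))) ⟩
  2 * sumCube {k} (λ _ → 1)                               ≡⟨ cong (2 *_) (sumCube-const {k} 1) ⟩
  2 * (1 * 2 ^ k)                                         ≡⟨ cong (2 *_) (*-identityˡ (2 ^ k)) ⟩
  2 ^ suc k                                               ≡⟨ *-identityˡ (2 ^ suc k) ⟨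
  1 * 2 ^ suc k                                           ∎
  where
  open ≡-Reasoning
  g' = g ∘ suc

column : ∀ {k n} → GenMatrix k n → Fin n → Word k
column G j i = G i j

nonzeroColumns : ∀ {k n} → GenMatrix k n → ℕ
nonzeroColumns G = sum (λ j → bit (not (isZeroᵇ (column G j))))

encode-cong : ∀ {k n} (G : GenMatrix k n) {x y : Word k} → x ≗ y → encode G x ≗ encode G y
encode-cong G x≗y j = Σ₂-cong (λ i → cong (_∧ G i j) (x≗y i))

encode-⊕ : ∀ {k n} (G : GenMatrix k n) (x y : Word k) → encode G (x ⊕ y) ≗ (encode G x ⊕ encode G y)
encode-⊕ G x y j = trans (Σ₂-cong (λ i → ∧-distribʳ-xor (G i j) (x i) (y i))) (Σ₂-xor (λ i → x i ∧ G i j) _)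

encode-zero : ∀ {k n} (G : GenMatrix k n) {x : Word k} → IsZero x → IsZero (encode G x)
encode-zero {k} G x≡0 j = trans (Σ₂-cong (λ i → cong (_∧ G i j) (x≡0 i))) (Σ₂-false {k})

nonzero-codeword⇒isZeroᵇ≡false : ∀ {k n} (G : GenMatrix k n) {x : Word k} →
                                  ¬ IsZero (encode G x) → isZeroᵇ x ≡ false
nonzero-codeword⇒isZeroᵇ≡false G {x} c≢0 with isZeroᵇ x in x≡0
... | true  = ⊥-elim (c≢0 (encode-zero G (isZeroᵇ⇒IsZero x≡0)))
... | false = refl

2*totalWeight : ∀ {k n} (G : GenMatrix k n) → 2 * sumCube (λ x → wt (encode G x)) ≡ nonzeroColumns G * 2 ^ k
2*totalWeight {k} G = begin
  2 * sumCube (λ x → wt (encode G x))                        ≡⟨ cong (2 *_) (sumCube-cong (λ x → wt≡sum (encode G x))) ⟩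
  2 * sumCube (λ x → sum (λ j → bit (x · column G j)))       ≡⟨ cong (2 *_) (sumCube-sum-comm (λ x j → bit (x · column G j))) ⟩
  2 * sum (λ j → onesOf (column G j))                         ≡⟨ *-distribˡ-sum 2 (λ j → onesOf (column G j)) ⟩
  sum (λ j → 2 * onesOf (column G j))                         ≡⟨ sum-cong-≗ (λ j → 2*onesOf (column G j)) ⟩
  sum (λ j → bit (not (isZeroᵇ (column G j))) * 2 ^ k)        ≡⟨ *-distribʳ-sum (2 ^ k) (λ j → bit (not (isZeroᵇ (column G j)))) ⟨
  nonzeroColumns G * 2 ^ k                                    ∎
  where open ≡-Reasoning

module DivisibleMinimalCode {n k Δ} .{{_ : NonZero Δ}} (C : LinCode n k)
                            (divisible : IsDivisible Δ C) (minimal : IsMinimal C) where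

  codeword : Word k → Word n
  codeword = encode (gen C)

  scaledWt : Word k → ℕ
  scaledWt x = _∣_.quotient (divisible x)

  wt≡scaledWt*Δ : ∀ x → wt (codeword x) ≡ scaledWt x * Δ
  wt≡scaledWt*Δ x = _∣_.equality (divisible x)

  scaledWt-cong : scaledWt Preserves _≗_ ⟶ _≡_
  scaledWt-cong {x} {y} x≗y = *-cancelʳ-≡ (scaledWt x) (scaledWt y) Δ
    (trans (sym (wt≡scaledWt*Δ x)) (trans (wt-cong (encode-cong (gen C) x≗y)) (wt≡scaledWt*Δ y)))

  scaledWt-zero : ∀ {x} → isZeroᵇ x ≡ true → scaledWt x ≡ 0
  scaledWt-zero {x} x≡0 = m*n≡0⇒m≡0 (scaledWt x) Δ
    (trans (sym (wt≡scaledWt*Δ x)) (IsZero⇒wt≡0 (encode-zero (gen C) (isZeroᵇ⇒IsZero x≡0))))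

  codeword-nonzero : ∀ {x} → isZeroᵇ x ≡ false → ¬ IsZero (codeword x)
  codeword-nonzero {x} x≢0 c≡0 with () ← trans (sym x≢0) (IsZero⇒isZeroᵇ (fullRank C x c≡0))

  scaledWt-nonzero : ∀ {x} → isZeroᵇ x ≡ false → scaledWt x ≢ 0
  scaledWt-nonzero {x} x≢0 s≡0 = codeword-nonzero x≢0 (wt≡0⇒IsZero (trans (wt≡scaledWt*Δ x) (cong (_* Δ) s≡0)))

  module WeightΔ {x₀ : Word k} (s₀≡1 : scaledWt x₀ ≡ 1) where

    x₀≢0 : isZeroᵇ x₀ ≡ false
    x₀≢0 with isZeroᵇ x₀ in x₀≡0
    ... | false = refl
    ... | true with () ← trans (sym (scaledWt-zero x₀≡0)) s₀≡1

    scaledWt-≤-translate : ∀ {x} → isZeroᵇ x ≡ false → isZeroᵇ (x ⊕ x₀) ≡ false → scaledWt x ≤ scaledWt (x ⊕ x₀)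
    scaledWt-≤-translate {x} x≢0 x⊕x₀≢0 with scaledWt x ≤? scaledWt (x ⊕ x₀)
    ... | yes s≤s' = s≤s'
    ... | no  s≰s' = ⊥-elim (minimal x (x ⊕ x₀) (codeword-nonzero x≢0) (codeword-nonzero x⊕x₀≢0)
          (tight-triangle⇒SuppStrictSub (codeword x) (codeword x₀) (codeword (x ⊕ x₀))
             (encode-⊕ (gen C) x x₀) (codeword-nonzero x₀≢0) tight))
      where
      open ≤-Reasoning
      tight : wt (codeword x₀) + wt (codeword (x ⊕ x₀)) ≤ wt (codeword x)
      tight = begin
        wt (codeword x₀) + wt (codeword (x ⊕ x₀))  ≡⟨ cong₂ _+_ (wt≡scaledWt*Δ x₀) (wt≡scaledWt*Δ (x ⊕ x₀)) ⟩
        scaledWt x₀ * Δ + scaledWt (x ⊕ x₀) * Δ    ≡⟨ cong (λ s → s * Δ + scaledWt (x ⊕ x₀) * Δ) s₀≡1 ⟩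
        1 * Δ + scaledWt (x ⊕ x₀) * Δ              ≡⟨ *-distribʳ-+ Δ 1 (scaledWt (x ⊕ x₀)) ⟨
        suc (scaledWt (x ⊕ x₀)) * Δ                ≤⟨ *-monoˡ-≤ Δ (≰⇒> s≰s') ⟩
        scaledWt x * Δ                             ≡⟨ wt≡scaledWt*Δ x ⟨
        wt (codeword x)                            ∎

    -- Translation by x₀ swaps 0 and x₀, and scaledWt⁺ gives both the value 1.
    scaledWt⁺ : Word k → ℕ
    scaledWt⁺ x = scaledWt x + bit (isZeroᵇ x)

    scaledWt⁺-cong : scaledWt⁺ Preserves _≗_ ⟶ _≡_
    scaledWt⁺-cong x≗y = cong₂ _+_ (scaledWt-cong x≗y) (cong bit (isZeroᵇ-cong x≗y))

    scaledWt⁺-zero : ∀ {x} → isZeroᵇ x ≡ true → scaledWt⁺ x ≡ 1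
    scaledWt⁺-zero {x} x≡0 = cong₂ _+_ (scaledWt-zero x≡0) (cong bit x≡0)

    scaledWt⁺-x₀ : scaledWt⁺ x₀ ≡ 1
    scaledWt⁺-x₀ = cong₂ _+_ s₀≡1 (cong bit x₀≢0)

    scaledWt⁺-translate : ∀ x → scaledWt⁺ (x ⊕ x₀) ≡ scaledWt⁺ x
    scaledWt⁺-translate x = cases refl refl
      where
      open ≡-Reasoning
      cases : ∀ {a b} → isZeroᵇ x ≡ a → isZeroᵇ (x ⊕ x₀) ≡ b → scaledWt⁺ (x ⊕ x₀) ≡ scaledWt⁺ x
      cases {true} x≡0 _ = begin
        scaledWt⁺ (x ⊕ x₀)  ≡⟨ scaledWt⁺-cong (⊕-identityˡ (isZeroᵇ⇒IsZero x≡0) x₀) ⟩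
        scaledWt⁺ x₀        ≡⟨ scaledWt⁺-x₀ ⟩
        1                 ≡⟨ scaledWt⁺-zero x≡0 ⟨
        scaledWt⁺ x         ∎
      cases {false} {true} _ x⊕x₀≡0 = begin
        scaledWt⁺ (x ⊕ x₀)  ≡⟨ scaledWt⁺-zero x⊕x₀≡0 ⟩
        1                 ≡⟨ scaledWt⁺-x₀ ⟨
        scaledWt⁺ x₀        ≡⟨ scaledWt⁺-cong (IsZero-⊕⇒≗ (isZeroᵇ⇒IsZero x⊕x₀≡0)) ⟨
        scaledWt⁺ x         ∎
      cases {false} {false} x≢0 x⊕x₀≢0 = cong₂ _+_
        (≤-antisym (≤-trans (scaledWt-≤-translate x⊕x₀≢0 (trans (isZeroᵇ-cong (⊕-cancelʳ x x₀)) x≢0))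
                            (≤-reflexive (scaledWt-cong (⊕-cancelʳ x x₀))))
                   (scaledWt-≤-translate x≢0 x⊕x₀≢0))
        (cong bit (trans x⊕x₀≢0 (sym x≢0)))

    sumCube-scaledWt-odd : 2 ∣ sumCube scaledWt + 1
    sumCube-scaledWt-odd = subst (2 ∣_) (trans (sumCube-distrib-+ scaledWt (bit ∘ isZeroᵇ)) (cong (sumCube scaledWt +_) (sumCube-isZeroᵇ {k})))
      (translation-invariant⇒2∣sumCube scaledWt⁺-cong x₀≢0 scaledWt⁺-translate)

lowerBound : ∀ {m n} (C : LinCode n (2 + m)) → IsDivisible (2 ^ m) C → IsMinimal C → 2 ^ (2 + m) ∸ 1 ≤ n
lowerBound {m} {n} C divisible minimal = m≤n+o⇒m∸n≤o (2 ^ (2 + m)) 1 (*-cancelˡ-≤ 2 (begin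
  2 * 2 ^ (2 + m)
    ≡⟨ sumCube-const {2 + m} 2 ⟨
  sumCube {2 + m} (λ _ → 2)
    ≤⟨ sumCube-mono-≤ 2≤scaledWt+2·isZero ⟩
  sumCube (λ x → scaledWt x + bit (isZeroᵇ x) * 2)
    ≡⟨ sumCube-distrib-+ scaledWt (λ x → bit (isZeroᵇ x) * 2) ⟩
  sumCube scaledWt + sumCube {2 + m} (λ x → bit (isZeroᵇ x) * 2)
    ≡⟨ cong₂ _+_ sumCube-scaledWt (trans (sumCube-*ʳ {2 + m} (bit ∘ isZeroᵇ) 2) (cong (_* 2) (sumCube-isZeroᵇ {2 + m}))) ⟩
  2 * N + 1 * 2
    ≡⟨ *-distribˡ-+ 2 N 1 ⟨
  2 * (N + 1)
    ≤⟨ *-monoʳ-≤ 2 (+-monoˡ-≤ 1 (sum-bit≤ (λ j → not (isZeroᵇ (column (gen C) j))))) ⟩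
  2 * (n + 1)
    ≡⟨ cong (2 *_) (+-comm n 1) ⟩
  2 * (1 + n)
    ∎))
  where
  open DivisibleMinimalCode {{m^n≢0 2 m}} C divisible minimal
  open ≤-Reasoning

  N : ℕ
  N = nonzeroColumns (gen C)

  sumCube-scaledWt : sumCube scaledWt ≡ 2 * N
  sumCube-scaledWt = *-cancelˡ-≡ _ _ 2 (*-cancelʳ-≡ _ _ (2 ^ m) {{m^n≢0 2 m}} (begin-equality
    2 * sumCube scaledWt * 2 ^ m                    ≡⟨ *-assoc 2 (sumCube scaledWt) (2 ^ m) ⟩
    2 * (sumCube scaledWt * 2 ^ m)                  ≡⟨ cong (2 *_) (sumCube-*ʳ scaledWt (2 ^ m)) ⟨
    2 * sumCube (λ x → scaledWt x * 2 ^ m)          ≡⟨ cong (2 *_) (sumCube-cong wt≡scaledWt*Δ) ⟨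
    2 * sumCube (λ x → wt (codeword x))             ≡⟨ 2*totalWeight (gen C) ⟩
    N * 2 ^ (2 + m)                                 ≡⟨ reassociate N (2 ^ m) ⟩
    2 * (2 * N) * 2 ^ m                             ∎))
    where
    reassociate : ∀ a b → a * (2 * (2 * b)) ≡ 2 * (2 * a) * b
    reassociate = solve-∀

  2≤scaledWt : ∀ {x} → isZeroᵇ x ≡ false → 2 ≤ scaledWt x
  2≤scaledWt {x} x≢0 with scaledWt x in s≡
  ... | 0           = ⊥-elim (scaledWt-nonzero x≢0 s≡)
  ... | 1           with () ← ∣1⇒≡1 (∣m+n∣m⇒∣n (subst (λ t → 2 ∣ t + 1) sumCube-scaledWt (WeightΔ.sumCube-scaledWt-odd s≡))
                                                   (divides N (*-comm 2 N)))
  ... | suc (suc _) = s≤s (s≤s z≤n)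

  2≤scaledWt+2·isZero : ∀ x → 2 ≤ scaledWt x + bit (isZeroᵇ x) * 2
  2≤scaledWt+2·isZero x with isZeroᵇ x in x≡0
  ... | true  = m≤n+m 2 (scaledWt x)
  ... | false = ≤-trans (2≤scaledWt x≡0) (m≤m+n (scaledWt x) 0)

-- The simplex code: its columns are all non-zero vectors of F₂ᵏ.

simplexLength : ℕ → ℕ
simplexLength zero    = 0
simplexLength (suc k) = suc (simplexLength k + simplexLength k)

simplexLength≡ : ∀ k → simplexLength k ≡ 2 ^ k ∸ 1
simplexLength≡ k = cong (_∸ 1) (1+simplexLength k)
  where
  1+simplexLength : ∀ k → suc (simplexLength k) ≡ 2 ^ k
  1+simplexLength zero    = refl
  1+simplexLength (suc k) = begin
    suc (suc (L + L))      ≡⟨ cong suc (+-suc L L) ⟨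
    suc L + suc L          ≡⟨ cong (λ t → t + t) (1+simplexLength k) ⟩
    2 ^ k + 2 ^ k          ≡⟨ cong (2 ^ k +_) (+-identityʳ (2 ^ k)) ⟨
    2 ^ suc k              ∎
    where
    open ≡-Reasoning
    L = simplexLength k

simplexColumns : ∀ k → Vector (Word k) (simplexLength k)
simplexColumns zero    = []
simplexColumns (suc k) = (true ∷ zeros) ∷ (map (false ∷_) (simplexColumns k) ++ map (true ∷_) (simplexColumns k))

sum-simplexColumns : ∀ {k} {f : Word k → ℕ} → f Preserves _≗_ ⟶ _≡_ →
                     f zeros + sum (map f (simplexColumns k)) ≡ sumCube f
sum-simplexColumns {zero}  {f} f-cong = trans (+-identityʳ (f zeros)) (f-cong (λ ()))
sum-simplexColumns {suc k} {f} f-cong = begin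
  f zeros + (f (true ∷ zeros) + sum (map f (map (false ∷_) cols ++ map (true ∷_) cols)))
    ≡⟨ cong₂ (λ a b → a + (f (true ∷ zeros) + b)) (f-cong zeros≗false∷zeros) (sum-++ f (map (false ∷_) cols) (map (true ∷_) cols)) ⟩
  f (false ∷ zeros) + (f (true ∷ zeros) + (sum (map (f ∘ (false ∷_)) cols) + sum (map (f ∘ (true ∷_)) cols)))
    ≡⟨ regroup (f (false ∷ zeros)) (f (true ∷ zeros)) _ _ ⟩
  (f (false ∷ zeros) + sum (map (f ∘ (false ∷_)) cols)) + (f (true ∷ zeros) + sum (map (f ∘ (true ∷_)) cols))
    ≡⟨ cong₂ _+_ (sum-simplexColumns (f-cong ∘ ∷-cong false)) (sum-simplexColumns (f-cong ∘ ∷-cong true)) ⟩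
  sumCube (f ∘ (false ∷_)) + sumCube (f ∘ (true ∷_))
    ∎
  where
  open ≡-Reasoning
  cols = simplexColumns k
  zeros≗false∷zeros : zeros ≗ (false ∷ zeros)
  zeros≗false∷zeros zero    = refl
  zeros≗false∷zeros (suc i) = refl
  regroup : ∀ a b c d → a + (b + (c + d)) ≡ (a + c) + (b + d)
  regroup = solve-∀

simplex : ∀ k → GenMatrix k (simplexLength k)
simplex k i j = simplexColumns k j i

2*wt-simplex : ∀ {k} (x : Word k) → 2 * wt (encode (simplex k) x) ≡ bit (not (isZeroᵇ x)) * 2 ^ k
2*wt-simplex {k} x = begin
  2 * wt (encode (simplex k) x)                                      ≡⟨ cong (2 *_) (wt≡sum (encode (simplex k) x)) ⟩
  2 * sum (map (λ v → bit (x · v)) (simplexColumns k))               ≡⟨ cong (λ b → 2 * (bit b + sum (map (λ v → bit (x · v)) (simplexColumns k)))) (·-zerosʳ x) ⟨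
  2 * (bit (x · zeros) + sum (map (λ v → bit (x · v)) (simplexColumns k)))
                                                                     ≡⟨ cong (2 *_) (sum-simplexColumns (cong bit ∘ ·-congˡ x)) ⟩
  2 * sumCube (λ v → bit (x · v))                                    ≡⟨ cong (2 *_) (sumCube-cong (λ v → cong bit (·-comm x v))) ⟩
  2 * onesOf x                                                       ≡⟨ 2*onesOf x ⟩
  bit (not (isZeroᵇ x)) * 2 ^ k                                      ∎
  where open ≡-Reasoning

simplex-fullRank : ∀ k → FullRank (simplex k)
simplex-fullRank k x c≡0 = isZeroᵇ⇒IsZero (not-injective (bit≡0⇒false (m*n≡0⇒m≡0 _ (2 ^ k) {{m^n≢0 2 k}}
  (trans (sym (2*wt-simplex x)) (cong (2 *_) (IsZero⇒wt≡0 c≡0))))))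

simplexCode : ∀ k → LinCode (simplexLength k) k
simplexCode k = code (simplex k) (simplex-fullRank k)

simplex-divisible : ∀ k → IsDivisible (2 ^ k) (simplexCode (suc k))
simplex-divisible k x = divides (bit (not (isZeroᵇ x))) (*-cancelˡ-≡ _ _ 2 (trans (2*wt-simplex x) (pull-2 (bit (not (isZeroᵇ x))) (2 ^ k))))
  where
  pull-2 : ∀ a b → a * (2 * b) ≡ 2 * (a * b)
  pull-2 = solve-∀

simplex-minimal : ∀ k → IsMinimal (simplexCode k)
simplex-minimal k x y c≢0 c'≢0 c'⊂c = <-irrefl (*-cancelˡ-≡ _ _ 2 (begin
  2 * wt (encode (simplex k) y)          ≡⟨ 2*wt-simplex y ⟩
  bit (not (isZeroᵇ y)) * 2 ^ k          ≡⟨ cong (λ b → bit (not b) * 2 ^ k) (nonzero-codeword⇒isZeroᵇ≡false (simplex k) c'≢0) ⟩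
  1 * 2 ^ k                              ≡⟨ cong (λ b → bit (not b) * 2 ^ k) (nonzero-codeword⇒isZeroᵇ≡false (simplex k) c≢0) ⟨
  bit (not (isZeroᵇ x)) * 2 ^ k          ≡⟨ 2*wt-simplex x ⟨
  2 * wt (encode (simplex k) x)          ∎)) (SuppStrictSub⇒wt< c'⊂c)
  where open ≡-Reasoning

simplex-hasDivMinCode : ∀ m → HasDivMinCode (2 ^ (2 + m) ∸ 1) (2 + m) (2 ^ m)
simplex-hasDivMinCode m = subst (λ n → HasDivMinCode n (2 + m) (2 ^ m)) (simplexLength≡ (2 + m))
  (simplexCode (2 + m) , ∣-trans (n∣m*n 2) ∘ simplex-divisible (suc m) , simplex-minimal (2 + m))

mainTheorem2 : ∀ (k : ℕ) → 2 ≤ k → MinLengthIs k (2 ^ (k ∸ 2)) (2 ^ k ∸ 1)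
mainTheorem2 (suc (suc m)) (s≤s (s≤s z≤n)) =
  simplex-hasDivMinCode m , λ n (C , divisible , minimal) → lowerBound C divisible minimal
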